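{- Let $q$ be a prime power with $q\equiv 5\pmod 8$. Then $\left|S_{\mathbb{F}_q}^{\mathrm{adv}_\infty}\cap S_{\mathbb{F}_q}^{\mathrm{back}_\infty}\right|=\frac14\left|S_{\mathbb{F}_q}^{\mathrm{adv}_\infty}\right|$ and $\left|S_{\mathbb{F}_q}^{\mathrm{adv}_\infty}\cap S_{\mathbb{F}_q}^{\mathrm{back}_\infty}\right|=\frac14\left|S_{\mathbb{F}_q}^{\mathrm{back}_\infty}\right|$; that is, exactly one quarter of the members of $S_{\mathbb{F}_q}^{\mathrm{adv}_\infty}$ lie in $S_{\mathbb{F}_q}^{\mathrm{back}_\infty}$, and exactly one quarter of the members of $S_{\mathbb{F}_q}^{\mathrm{back}_\infty}$ lie in $S_{\mathbb{F}_q}^{\mathrm{adv}_\infty}$.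
   Context: Let $K$ be a field of characteristic not $2$. $S_K=\{(\alpha,\beta)\in K^2:\alpha,\beta,\alpha+\beta,\alpha-\beta\neq 0\}$. For $(\alpha,\beta),(\gamma,\delta)\in S_K$ write $(\alpha,\beta)\mapsto(\gamma,\delta)$ if $2\gamma=\alpha+\beta$ and $\delta^2=\alpha\beta$. For $n\ge0$, $S_K^{\mathrm{adv}_n}$ (resp. $S_K^{\mathrm{back}_n}$) is the set of $x_0\in S_K$ admitting $x_1,\dots,x_n\in S_K$ with $x_0\mapsto x_1\mapsto\cdots\mapsto x_n$ (resp. $x_{ -1},\dots,x_{ -n}\in S_K$ with $x_{ -n}\mapsto\cdots\mapsto x_{ -1}\mapsto x_0$); $S_K^{\mathrm{adv}_\infty}=\bigcap_n S_K^{\mathrm{adv}_n}$ and $S_K^{\mathrm{back}_\infty}=\bigcap_n S_K^{\mathrm{back}_n}$. -}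

module Defs where

open import Level using (0ℓ)
open import Data.Nat using (ℕ; zero; suc; _^_)
open import Data.Nat.Primality using (Prime)
open import Data.Fin using (Fin)
open import Data.Product using (Σ; ∃; _×_; _,_; proj₁; proj₂)
open import Data.List using (List; length)
open import Data.List.Membership.Propositional using (_∈_)
open import Data.List.Relation.Unary.Unique.Propositional using (Unique)
open import Function.Bundles using (_⇔_)
open import Relation.Binary.PropositionalEquality using (_≡_)
open import Relation.Nullary using (¬_)
open import Algebra.Core using (Op₁; Op₂)
open import Algebra.Structures using (IsCommutativeRing)

IsPrimePower : ℕ → Set
IsPrimePower q = Σ ℕ λ p → Σ ℕ λ k → Prime p × q ≡ p ^ suc k

record Field (A : Set) : Set where
  field
    _+_ _*_ : Op₂ A
    -_      : Op₁ A
    0# 1#   : A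
    isCommutativeRing : IsCommutativeRing _≡_ _+_ _*_ -_ 0# 1#
    0≢1     : ¬ (0# ≡ 1#)
    inverse : ∀ x → ¬ (x ≡ 0#) → Σ A λ y → x * y ≡ 1#

module FieldDefs {A : Set} (F : Field A) where
  open Field F

  _-_ : Op₂ A
  x - y = x + (- y)

  2# : A
  2# = 1# + 1#

  S : A × A → Set
  S (α , β) = ¬ (α ≡ 0#) × ¬ (β ≡ 0#) × ¬ (α + β ≡ 0#) × ¬ (α - β ≡ 0#)

  _↦_ : A × A → A × A → Set
  (α , β) ↦ (γ , δ) = S (α , β) × S (γ , δ) × (2# * γ ≡ α + β) × (δ * δ ≡ α * β)

  Adv : ℕ → A × A → Set
  Adv zero    x = S x
  Adv (suc n) x = Σ (A × A) λ y → (x ↦ y) × Adv n y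

  Back : ℕ → A × A → Set
  Back zero    x = S x
  Back (suc n) x = Σ (A × A) λ y → (y ↦ x) × Back n y

  AdvInf : A × A → Set
  AdvInf x = ∀ n → Adv n x

  BackInf : A × A → Set
  BackInf x = ∀ n → Back n x

HasSize : {A : Set} → (A → Set) → ℕ → Set
HasSize {A} P m = Σ (List A) λ l → Unique l × (∀ x → (x ∈ l) ⇔ P x) × length l ≡ m

module Submission where

-- Over F_q with q ≡ 5 (mod 8), −1 = i² is a square, i is not, and the product of two
-- non-squares is a square.  A point (α, β) has a successor iff αβ is a square, and its
-- successors are then (γ, ±δ); the predecessors of (α, β) are (α + e, α − e) with
-- e² = α² − β², and such a predecessor has itself a predecessor iff αe is a square.
-- For (α, β) ↦ (γ, δ) ↦ (m, ρ) and (γ, −δ) ↦ (m′, iρ) one has 16·(mρ)(m′·iρ) = ((α − β)ρ)²·i,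
-- so exactly one of (γ, ±δ) has a two-step future; for (α + e, α − e) ↦ (α, β) ↦ (γ, δ) and
-- (β + ie, β − ie) ↦ (β, α) one has αe·β(ie) = (δe)²·i, so exactly one of (α, β), (β, α)
-- has a two-step past.  Hence every point of S^adv∞ has a unique successor in S^adv∞, this
-- successor map is two-to-one with fibres {(α, β), (β, α)}, and its second iterate maps
-- S^adv∞ onto S^adv∞ ∩ S^back∞: a factor 4.  Reversing the arrows exchanges the roles of
-- (α, β) ↦ (β, α) and (γ, δ) ↦ (γ, −δ) and gives the same factor for S^back∞.

open import Defs
open import Level using (0ℓ)
open import Algebra.Bundles using (CommutativeRing)
import Data.Integer.Base as ℤ
import Data.Integer.Properties as ℤ
open import Data.Empty using (⊥)
open import Data.Fin.Base as Fin using (Fin)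
import Data.Fin.Properties as Fin
open import Data.List.Base using (List; []; _∷_; length; map; filter; allFin)
open import Data.List.Properties using (length-map; length-tabulate)
open import Data.List.Membership.Propositional using (_∈_; lose; find)
open import Data.List.Membership.Propositional.Properties
  using (∈-map⁺; ∈-map⁻; ∈-filter⁺; ∈-filter⁻; ∈-allFin)
open import Data.List.Membership.Propositional.Properties.WithK using (unique∧set⇒bag)
open import Data.List.Relation.Binary.BagAndSetEquality using (∼bag⇒↭)
open import Data.List.Relation.Binary.Permutation.Propositional.Properties using (↭-length)
import Data.List.Relation.Unary.All as All
import Data.List.Relation.Unary.All.Properties as All
open import Data.List.Relation.Unary.Any using (Any; here; there; any?)
open import Data.List.Relation.Unary.Unique.Propositional using (Unique; []; _∷_)
import Data.List.Relation.Unary.Unique.Propositional.Properties as Unique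
open import Data.Maybe.Base using (Maybe; just; nothing)
open import Data.Nat.Base as ℕ using (ℕ; zero; suc; _≤_; z≤n; s≤s; _<_)
import Data.Nat.DivMod as ℕ
import Data.Nat.Properties as ℕ
open import Data.Nat.Solver using (module +-*-Solver)
open import Data.Product.Base using (Σ; ∃; _×_; _,_; proj₁; proj₂; swap)
open import Data.Sign.Base as Sign using (Sign)
open import Data.Sum.Base as Sum using (_⊎_; inj₁; inj₂; [_,_]′)
open import Data.Unit.Base using (tt)
open import Function.Base using (id; flip; _∘_)
open import Function.Bundles using (_⇔_; mk⇔; Equivalence; _↣_; mk↣; Injection)
open import Relation.Binary.Definitions using (DecidableEquality)
open import Relation.Binary.PropositionalEquality
  using (_≡_; _≢_; refl; sym; trans; cong; cong₂; subst; module ≡-Reasoning)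
open import Relation.Nullary.Decidable
  using (Dec; yes; no; ¬?; _×-dec_; map′; decidable-stable; via-injection)
open import Relation.Nullary.Negation using (¬_; contradiction)
open import Relation.Unary using (Pred; Decidable; U; _⊆_; _≐_; _∩_; ∁)

-- Ring solver with integer coefficients

module IntegerCoefficients {c ℓ} (R : CommutativeRing c ℓ) where
  open CommutativeRing R renaming (refl to ≈-refl; sym to ≈-sym; trans to ≈-trans)
  open import Algebra.Properties.Ring ring using (-0#≈0#; -‿involutive; -‿+-comm; -1*x≈-x)
  open import Algebra.Properties.CommutativeSemigroup +-commutativeSemigroup
    using () renaming (interchange to +-interchange)
  open import Algebra.Properties.CommutativeSemigroup *-commutativeSemigroup
    using () renaming (interchange to *-interchange)
  open import Algebra.Properties.Semiring.Mult.TCOptimised semiring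
    using (×-homo-+; ×1-homo-*) renaming (_×_ to _·_)
  open import Algebra.Solver.Ring.AlmostCommutativeRing
    using (fromCommutativeRing; _-Raw-AlmostCommutative⟶_)
  open import Relation.Binary.Reasoning.Setoid setoid

  private
    fromℤ : ℤ.ℤ → Carrier
    fromℤ (ℤ.+ n) = n · 1#
    fromℤ ℤ.-[1+ n ] = - (suc n · 1#)

    fromSign : Sign → Carrier
    fromSign Sign.+ = 1#
    fromSign Sign.- = - 1#

    shift : ∀ x a b → (x + a) - (x + b) ≈ a - b
    shift x a b = begin
      (x + a) - (x + b)       ≈⟨ +-congˡ (-‿+-comm x b) ⟨
      (x + a) + (- x + - b)   ≈⟨ +-interchange x a (- x) (- b) ⟩
      (x - x) + (a - b)       ≈⟨ +-congʳ (-‿inverseʳ x) ⟩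
      0# + (a - b)            ≈⟨ +-identityˡ _ ⟩
      a - b                   ∎

    fromℤ-⊖ : ∀ m n → fromℤ (m ℤ.⊖ n) ≈ m · 1# - n · 1#
    fromℤ-⊖ m zero = ≈-sym (≈-trans (+-congˡ -0#≈0#) (+-identityʳ _))
    fromℤ-⊖ zero (suc n) = ≈-sym (+-identityˡ _)
    fromℤ-⊖ (suc m) (suc n) = begin
      fromℤ (suc m ℤ.⊖ suc n)         ≡⟨ cong fromℤ (ℤ.[1+m]⊖[1+n]≡m⊖n m n) ⟩
      fromℤ (m ℤ.⊖ n)                 ≈⟨ fromℤ-⊖ m n ⟩
      m · 1# - n · 1#                 ≈⟨ shift 1# _ _ ⟨
      (1# + m · 1#) - (1# + n · 1#)   ≈⟨ +-cong (×-homo-+ 1# 1 m) (-‿cong (×-homo-+ 1# 1 n)) ⟨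
      suc m · 1# - suc n · 1#         ∎

    fromℤ-+ : ∀ i j → fromℤ (i ℤ.+ j) ≈ fromℤ i + fromℤ j
    fromℤ-+ (ℤ.+ m) (ℤ.+ n) = ×-homo-+ 1# m n
    fromℤ-+ (ℤ.+ m) ℤ.-[1+ n ] = fromℤ-⊖ m (suc n)
    fromℤ-+ ℤ.-[1+ m ] (ℤ.+ n) = ≈-trans (fromℤ-⊖ n (suc m)) (+-comm _ _)
    fromℤ-+ ℤ.-[1+ m ] ℤ.-[1+ n ] = begin
      - (suc (suc (m ℕ.+ n)) · 1#)     ≡⟨ cong (λ k → - (suc k · 1#)) (ℕ.+-suc m n) ⟨
      - ((suc m ℕ.+ suc n) · 1#)       ≈⟨ -‿cong (×-homo-+ 1# (suc m) (suc n)) ⟩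
      - (suc m · 1# + suc n · 1#)      ≈⟨ -‿+-comm _ _ ⟨
      - (suc m · 1#) + - (suc n · 1#)  ∎

    fromℤ-◃ : ∀ s n → fromℤ (s ℤ.◃ n) ≈ fromSign s * (n · 1#)
    fromℤ-◃ s zero = ≈-sym (zeroʳ _)
    fromℤ-◃ Sign.+ (suc n) = ≈-sym (*-identityˡ _)
    fromℤ-◃ Sign.- (suc n) = ≈-sym (-1*x≈-x _)

    fromℤ-signAbs : ∀ i → fromℤ i ≈ fromSign (ℤ.sign i) * (ℤ.∣ i ∣ · 1#)
    fromℤ-signAbs (ℤ.+ n) = ≈-sym (*-identityˡ _)
    fromℤ-signAbs ℤ.-[1+ n ] = ≈-sym (-1*x≈-x _)

    fromSign-* : ∀ s t → fromSign (s Sign.* t) ≈ fromSign s * fromSign t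
    fromSign-* Sign.+ t = ≈-sym (*-identityˡ _)
    fromSign-* Sign.- Sign.+ = ≈-sym (*-identityʳ _)
    fromSign-* Sign.- Sign.- = ≈-sym (≈-trans (-1*x≈-x _) (-‿involutive _))

    fromℤ-* : ∀ i j → fromℤ (i ℤ.* j) ≈ fromℤ i * fromℤ j
    fromℤ-* i j = begin
      fromℤ (s ℤ.◃ ℤ.∣ i ∣ ℕ.* ℤ.∣ j ∣)                           ≈⟨ fromℤ-◃ s (ℤ.∣ i ∣ ℕ.* ℤ.∣ j ∣) ⟩
      fromSign s * ((ℤ.∣ i ∣ ℕ.* ℤ.∣ j ∣) · 1#)                    ≈⟨ *-cong (fromSign-* (ℤ.sign i) (ℤ.sign j))
                                                                          (×1-homo-* ℤ.∣ i ∣ ℤ.∣ j ∣) ⟩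
      (fromSign (ℤ.sign i) * fromSign (ℤ.sign j)) * (∣i∣ * ∣j∣)     ≈⟨ *-interchange _ _ _ _ ⟩
      (fromSign (ℤ.sign i) * ∣i∣) * (fromSign (ℤ.sign j) * ∣j∣)     ≈⟨ *-cong (fromℤ-signAbs i) (fromℤ-signAbs j) ⟨
      fromℤ i * fromℤ j                                            ∎
      where
      s = ℤ.sign i Sign.* ℤ.sign j
      ∣i∣ = ℤ.∣ i ∣ · 1#
      ∣j∣ = ℤ.∣ j ∣ · 1#

    fromℤ-neg : ∀ i → fromℤ (ℤ.- i) ≈ - fromℤ i
    fromℤ-neg (ℤ.+ zero) = ≈-sym -0#≈0#
    fromℤ-neg (ℤ.+ suc n) = ≈-refl
    fromℤ-neg ℤ.-[1+ n ] = ≈-sym (-‿involutive _)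

    homomorphism : ℤ.+-*-rawRing -Raw-AlmostCommutative⟶ fromCommutativeRing R
    homomorphism = record
      { ⟦_⟧ = fromℤ ; +-homo = fromℤ-+ ; *-homo = fromℤ-* ; -‿homo = fromℤ-neg
      ; 0-homo = ≈-refl ; 1-homo = ≈-refl }

    fromℤ-≟ : ∀ i j → Maybe (fromℤ i ≈ fromℤ j)
    fromℤ-≟ i j with i ℤ.≟ j
    ... | yes refl = just ≈-refl
    ... | no _ = nothing

  open import Algebra.Solver.Ring ℤ.+-*-rawRing (fromCommutativeRing R) homomorphism fromℤ-≟ public
    using (Polynomial; solve; _:=_; _:+_; _:*_; _:-_; :-_; con)

  :1 :2 : ∀ {n} → Polynomial n
  :1 = con (ℤ.+ 1)
  :2 = con (ℤ.+ 2)

-- Counting finite sets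

record IsFreeInvolution {X : Set} (P : Pred X 0ℓ) (σ : X → X) : Set where
  field
    closed : ∀ {x} → P x → P (σ x)
    involutive : ∀ {x} → P x → σ (σ x) ≡ x
    no-fixed-point : ∀ {x} → P x → σ x ≢ x

restrict : ∀ {X : Set} {P Q : Pred X 0ℓ} {σ : X → X} →
           IsFreeInvolution P σ → Q ⊆ P → (∀ {x} → Q x → Q (σ x)) → IsFreeInvolution Q σ
restrict σ-free Q⊆P Q-σ = record
  { closed = Q-σ ; involutive = involutive ∘ Q⊆P ; no-fixed-point = no-fixed-point ∘ Q⊆P }
  where open IsFreeInvolution σ-free

module _ {X : Set} where
  open import Data.Nat.Base using (_+_; _*_)
  open ≡-Reasoning

  Image : (X → X) → Pred X 0ℓ → Pred X 0ℓ
  Image h P y = ∃ λ x → P x × h x ≡ y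

  private
    variable
      P Q : Pred X 0ℓ
      m n : ℕ

    length-filter-∁ : (Q? : Decidable Q) (xs : List X) →
                      length xs ≡ length (filter Q? xs) + length (filter (¬? ∘ Q?) xs)
    length-filter-∁ Q? [] = refl
    length-filter-∁ Q? (x ∷ xs) with Q? x
    ... | yes _ = cong suc (length-filter-∁ Q? xs)
    ... | no _ = trans (cong suc (length-filter-∁ Q? xs)) (sym (ℕ.+-suc _ _))

    map⁺ : (h : X → X) {xs : List X} → (∀ {x x′} → x ∈ xs → x′ ∈ xs → h x ≡ h x′ → x ≡ x′) →
           Unique xs → Unique (map h xs)
    map⁺ h inj [] = []
    map⁺ h inj (x∉ ∷ xs!) =
      All.map⁺ (All.tabulate (λ y∈ hx≡hy → All.lookup x∉ y∈ (inj (here refl) (there y∈) hx≡hy)))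
      ∷ map⁺ h (λ x∈ x′∈ → inj (there x∈) (there x′∈)) xs!

  HasSize-cong : P ≐ Q → HasSize P m → HasSize Q m
  HasSize-cong (P⊆Q , Q⊆P) (l , l! , l⇔P , ∣l∣) =
    l , l! , (λ x → mk⇔ (P⊆Q ∘ Equivalence.to (l⇔P x)) (Equivalence.from (l⇔P x) ∘ Q⊆P)) , ∣l∣

  HasSize-unique : HasSize P m → HasSize Q n → P ≐ Q → m ≡ n
  HasSize-unique (l , l! , l⇔P , refl) (k , k! , k⇔Q , refl) (P⊆Q , Q⊆P) =
    ↭-length (∼bag⇒↭ (unique∧set⇒bag l! k! (λ {x} → mk⇔
      (Equivalence.from (k⇔Q x) ∘ P⊆Q ∘ Equivalence.to (l⇔P x))
      (Equivalence.from (l⇔P x) ∘ Q⊆P ∘ Equivalence.to (k⇔Q x)))))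

  HasSize-∩ : HasSize P m → (Q? : Decidable Q) → ∃ λ n → HasSize (P ∩ Q) n
  HasSize-∩ (l , l! , l⇔P , _) Q? = _ , filter Q? l , Unique.filter⁺ Q? l! , (λ x → mk⇔
    (λ x∈ → let x∈l , q = ∈-filter⁻ Q? x∈ in Equivalence.to (l⇔P x) x∈l , q)
    (λ (p , q) → ∈-filter⁺ Q? (Equivalence.from (l⇔P x) p) q)) , refl

  HasSize-decidable : ∀ {N} → HasSize U N → Decidable P → ∃ λ m → HasSize P m
  HasSize-decidable everything P? =
    let m , S = HasSize-∩ everything P? in m , HasSize-cong (proj₂ , (tt ,_)) S

  HasSize-partition : (Q? : Decidable Q) → HasSize P m →
                      ∀ {a b} → HasSize (P ∩ Q) a → HasSize (P ∩ ∁ Q) b → m ≡ a + b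
  HasSize-partition {P = P} Q? S@(l , _ , _ , refl) {a} {b} S∩Q S∩∁Q = begin
    length l                                           ≡⟨ length-filter-∁ Q? l ⟩
    length (filter Q? l) + length (filter (¬? ∘ Q?) l) ≡⟨ cong₂ _+_ (filtered Q? S∩Q)
                                                                    (filtered (¬? ∘ Q?) S∩∁Q) ⟩
    a + b                                              ∎
    where
    filtered : ∀ {R} (R? : Decidable R) {k} → HasSize (P ∩ R) k → length (filter R? l) ≡ k
    filtered R? S∩R = HasSize-unique (proj₂ (HasSize-∩ S R?)) S∩R (id , id)

  HasSize-image : {h : X → X} → (∀ {x x′} → P x → P x′ → h x ≡ h x′ → x ≡ x′) →
                  HasSize P m → HasSize (Image h P) m
  HasSize-image {h = h} inj (l , l! , l⇔P , refl) =
    map h l , map⁺ h (λ x∈ x′∈ → inj (∈P x∈) (∈P x′∈)) l! ,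
    (λ y → mk⇔ (λ y∈ → let x , x∈ , y≡hx = ∈-map⁻ h y∈ in x , ∈P x∈ , sym y≡hx)
               (λ { (x , p , refl) → ∈-map⁺ h (Equivalence.from (l⇔P x) p) })) ,
    length-map h l
    where ∈P = λ {x} → Equivalence.to (l⇔P x)

  HasSize-∃? : HasSize P m → Decidable Q → Dec (∃ λ x → P x × Q x)
  HasSize-∃? (l , _ , l⇔P , _) Q? with any? Q? l
  ... | yes q∈l = let x , x∈ , q = find q∈l in yes (x , Equivalence.to (l⇔P x) x∈ , q)
  ... | no ¬q∈l = no λ (x , p , q) → ¬q∈l (lose (Equivalence.from (l⇔P x) p) q)

  HasSize-⊆⇒⊇ : Decidable P → HasSize P m → HasSize Q m → P ⊆ Q → Q ⊆ P
  HasSize-⊆⇒⊇ {P = P} {m = m} P? SP SQ P⊆Q {y} q with P? y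
  ... | yes p = p
  ... | no ¬p =
    let a , SQ∩P = HasSize-∩ SQ P?
        b , SQ∩∁P = HasSize-∩ SQ (¬? ∘ P?)
        a≡m = HasSize-unique SQ∩P SP (proj₂ , λ p → P⊆Q p , p)
        m+0≡m+b = trans (ℕ.+-identityʳ m) (trans (HasSize-partition P? SQ SQ∩P SQ∩∁P) (cong (_+ b) a≡m))
    in contradiction (q , ¬p) (empty (subst (HasSize _) (sym (ℕ.+-cancelˡ-≡ m 0 b m+0≡m+b)) SQ∩∁P))
    where
    empty : ∀ {R : Pred X 0ℓ} → HasSize R 0 → ∀ {x} → ¬ R x
    empty ([] , _ , l⇔R , _) {x} r with () ← Equivalence.from (l⇔R x) r

  choice : (R : X → X → Set) → (∀ x y → Dec (R x y)) → HasSize Q n →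
           Σ (X → X) λ f → ∀ {x y} → Q y → R x y → Q (f x) × R x (f x)
  choice {Q = Q} R R? (l , _ , l⇔Q , _) =
    (λ x → pick x (any? (R? x) l)) ,
    λ {x} q r → pick-spec x (any? (R? x) l) (lose (Equivalence.from (l⇔Q _) q) r)
    where
    pick : (x : X) → Dec (Any (R x) l) → X
    pick x (yes r∈l) = proj₁ (find r∈l)
    pick x (no _) = x
    pick-spec : (x : X) (d : Dec (Any (R x) l)) → Any (R x) l → Q (pick x d) × R x (pick x d)
    pick-spec x (yes r∈l) _ = let y , y∈ , r = find r∈l in Equivalence.to (l⇔Q y) y∈ , r
    pick-spec x (no ¬r∈l) r∈l = contradiction r∈l ¬r∈l

  module _ (_≟_ : DecidableEquality X) where

    Image? : {h : X → X} → HasSize P m → Decidable (Image h P)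
    Image? {h = h} S y = HasSize-∃? S (λ x → h x ≟ y)

    HasSize-remove : HasSize P m → ∀ {a} → P a →
                     ∃ λ n → HasSize (λ x → P x × x ≢ a) n × m ≡ suc n
    HasSize-remove S {a} pa =
      let n , S∖a = HasSize-∩ S (λ x → ¬? (x ≟ a))
      in n , S∖a , HasSize-partition (_≟ a) S singleton S∖a
      where
      singleton : HasSize (λ x → _ × x ≡ a) 1
      singleton = a ∷ [] , All.[] ∷ [] ,
        (λ x → mk⇔ (λ { (here refl) → pa , refl }) (λ { (_ , refl) → here refl })) , refl

  -- An injection into ℕ picks one element of each σ-orbit: the one that σ moves upwards.
  module _ (ι : X ↣ ℕ) {σ : X → X} (σ-free : IsFreeInvolution P σ) where
    open Injection ι using (to; injective)
    open IsFreeInvolution σ-free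

    private
      Ascends : Pred X 0ℓ
      Ascends x = to x < to (σ x)

      Ascends? : Decidable Ascends
      Ascends? x = to x ℕ.<? to (σ x)

      not-both : ∀ {x} → P x → Ascends x → ¬ Ascends (σ x)
      not-both p up up′ = ℕ.<-asym up (subst (λ z → to (σ _) < to z) (involutive p) up′)

      one-of : ∀ {x} → P x → ¬ Ascends x → Ascends (σ x)
      one-of p ¬up = subst (λ z → to (σ _) < to z) (sym (involutive p))
        (ℕ.≤∧≢⇒< (ℕ.≮⇒≥ ¬up) (no-fixed-point p ∘ injective))

      σ[up]≐down : Image σ (P ∩ Ascends) ≐ P ∩ ∁ Ascends
      σ[up]≐down = (λ { (_ , (p , up) , refl) → closed p , not-both p up })
                 , λ (p , ¬up) → _ , (closed p , one-of p ¬up) , involutive p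

      ascending-half : HasSize P m → ∃ λ a → HasSize (P ∩ Ascends) a × m ≡ 2 * a
      ascending-half {m} S =
        let a , S↑ = HasSize-∩ S Ascends?
            b , S↓ = HasSize-∩ S (¬? ∘ Ascends?)
            a≡b = HasSize-unique (HasSize-image σ-injective S↑) S↓ σ[up]≐down
        in a , S↑ , (begin
             m        ≡⟨ HasSize-partition Ascends? S S↑ S↓ ⟩
             a + b    ≡⟨ cong (a +_) a≡b ⟨
             a + a    ≡⟨ cong (a +_) (ℕ.+-identityʳ a) ⟨
             2 * a    ∎)
        where
        σ-injective : ∀ {x x′} → (P ∩ Ascends) x → (P ∩ Ascends) x′ → σ x ≡ σ x′ → x ≡ x′
        σ-injective (p , _) (p′ , _) e = trans (sym (involutive p)) (trans (cong σ e) (involutive p′))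

    even-size : HasSize P m → ∃ λ a → m ≡ 2 * a
    even-size S = let a , _ , m≡2a = ascending-half S in a , m≡2a

    two-to-one : {h : X → X} → (∀ {x x′} → P x → P x′ → h x ≡ h x′ ⇔ (x′ ≡ x ⊎ x′ ≡ σ x)) →
                 HasSize P m → HasSize (Image h P) n → m ≡ 2 * n
    two-to-one {h = h} fibres S S-image =
      let a , S↑ , m≡2a = ascending-half S
      in trans m≡2a (cong (2 *_) (HasSize-unique (HasSize-image h-injective S↑) S-image h[up]≐h[P]))
      where
      h-injective : ∀ {x x′} → (P ∩ Ascends) x → (P ∩ Ascends) x′ → h x ≡ h x′ → x ≡ x′
      h-injective (p , up) (p′ , up′) hx≡hx′ with Equivalence.to (fibres p p′) hx≡hx′
      ... | inj₁ refl = refl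
      ... | inj₂ refl = contradiction up′ (not-both p up)
      h[up]≐h[P] : Image h (P ∩ Ascends) ≐ Image h P
      h[up]≐h[P] = (λ (x , (p , _) , hx≡y) → x , p , hx≡y) , λ { (x , p , refl) → representative x p }
        where
        representative : ∀ x → P x → Image h (P ∩ Ascends) (h x)
        representative x p with Ascends? x
        ... | yes up = x , (p , up) , refl
        ... | no ¬up =
          σ x , (closed p , one-of p ¬up) , sym (Equivalence.from (fibres p (closed p)) (inj₂ refl))

-- Chains of a relation, and relations whose arrows come in blocks {x, σ x} × {y, τ y}

module Chains {X : Set} (_⟶_ : X → X → Set) (S : Pred X 0ℓ) where
  open import Data.Nat.Base using (_+_)

  Chain : ℕ → Pred X 0ℓ
  Chain zero = S
  Chain (suc n) x = ∃ λ y → x ⟶ y × Chain n y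

  Chain∞ : Pred X 0ℓ
  Chain∞ x = ∀ n → Chain n x

  module _ (source-S : ∀ {x y} → x ⟶ y → S x) where

    Chain⇒S : ∀ {n x} → Chain n x → S x
    Chain⇒S {zero} s = s
    Chain⇒S {suc n} (_ , x⟶y , _) = source-S x⟶y

    Chain-≤ : ∀ {m n x} → m ≤ n → Chain n x → Chain m x
    Chain-≤ z≤n c = Chain⇒S c
    Chain-≤ (s≤s m≤n) (y , x⟶y , c) = y , x⟶y , Chain-≤ m≤n c

    Chain∞-pred : ∀ {x y} → x ⟶ y → Chain∞ y → Chain∞ x
    Chain∞-pred x⟶y c∞ zero = source-S x⟶y
    Chain∞-pred x⟶y c∞ (suc n) = _ , x⟶y , c∞ n

    Chain∞-successor : (∀ {x y y′} → x ⟶ y → x ⟶ y′ → Chain 2 y → Chain 2 y′ → y ≡ y′) →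
                       ∀ {x} → Chain∞ x → ∃ λ y → x ⟶ y × Chain∞ y
    Chain∞-successor determined c∞ with c∞ 3
    ... | y , x⟶y , c₂ = y , x⟶y , λ n →
      let y′ , x⟶y′ , c = c∞ (suc (2 + n))
      in subst (Chain n) (sym (determined x⟶y x⟶y′ c₂ (Chain-≤ (ℕ.m≤m+n 2 n) c)))
               (Chain-≤ (ℕ.m≤n+m n 2) c)

  Chain-σ : ∀ {σ : X → X} → (∀ {x} → S x → S (σ x)) → (∀ {x y} → x ⟶ y → σ x ⟶ y) →
            ∀ {n x} → Chain n x → Chain n (σ x)
  Chain-σ S-σ ⟶-σ {zero} s = S-σ s
  Chain-σ S-σ ⟶-σ {suc n} (y , x⟶y , c) = y , ⟶-σ x⟶y , c

  Chain∞-of-closed : ∀ {P : Pred X 0ℓ} → P ⊆ S → (∀ {x} → P x → ∃ λ y → x ⟶ y × P y) →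
                     P ⊆ Chain∞
  Chain∞-of-closed P⊆S step p zero = P⊆S p
  Chain∞-of-closed P⊆S step p (suc n) =
    let y , x⟶y , p′ = step p in y , x⟶y , Chain∞-of-closed P⊆S step p′ n

record TwoToTwo {X : Set} (_⟶_ : X → X → Set) (S : Pred X 0ℓ) (σ τ : X → X) : Set where
  open Chains _⟶_ S using () renaming (Chain to Fwd)
  open Chains (flip _⟶_) S using () renaming (Chain to Bwd)
  field
    σ-free : IsFreeInvolution S σ
    τ-free : IsFreeInvolution S τ
    source-S : ∀ {x y} → x ⟶ y → S x
    target-S : ∀ {x y} → x ⟶ y → S y
    σ-source : ∀ {x y} → x ⟶ y → σ x ⟶ y
    τ-target : ∀ {x y} → x ⟶ y → x ⟶ τ y
    sources : ∀ {x x′ y} → x ⟶ y → x′ ⟶ y → x′ ≡ x ⊎ x′ ≡ σ x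
    targets : ∀ {x y y′} → x ⟶ y → x ⟶ y′ → y′ ≡ y ⊎ y′ ≡ τ y
    σ-target : ∀ {x y} → x ⟶ y → ∃ λ x′ → x′ ⟶ σ y
    τ-source : ∀ {x y} → x ⟶ y → ∃ λ y′ → τ x ⟶ y′
    forward-determined : ∀ {x y y′} → x ⟶ y → x ⟶ y′ → Fwd 2 y → Fwd 2 y′ → y ≡ y′
    backward-determined : ∀ {x x′ y} → x ⟶ y → x′ ⟶ y → Bwd 2 x → Bwd 2 x′ → x ≡ x′
    forward-branch : ∀ {x y} → x ⟶ y → Fwd 1 y → Fwd 2 y ⊎ Fwd 2 (τ y)
    backward-branch : ∀ {x y} → x ⟶ y → Bwd 1 x → Bwd 2 x ⊎ Bwd 2 (σ x)

dual : ∀ {X : Set} {_⟶_ : X → X → Set} {S σ τ} → TwoToTwo _⟶_ S σ τ → TwoToTwo (flip _⟶_) S τ σ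
dual T = record
  { σ-free = τ-free ; τ-free = σ-free
  ; source-S = target-S ; target-S = source-S
  ; σ-source = τ-target ; τ-target = σ-source
  ; sources = targets ; targets = sources
  ; σ-target = τ-source ; τ-source = σ-target
  ; forward-determined = backward-determined ; backward-determined = forward-determined
  ; forward-branch = backward-branch ; backward-branch = forward-branch
  }
  where open TwoToTwo T

module Quarter {X : Set} {_⟶_ : X → X → Set} {S : Pred X 0ℓ} {σ τ : X → X}
               (T : TwoToTwo _⟶_ S σ τ) (ι : X ↣ ℕ) (_⟶?_ : ∀ x y → Dec (x ⟶ y)) where
  open TwoToTwo T
  open import Data.Nat.Base using (_*_)
  private
    module F = Chains _⟶_ S
    module B = Chains (flip _⟶_) S
  open F using () renaming (Chain∞ to Fwd∞)
  open B using () renaming (Chain to Bwd; Chain∞ to Bwd∞)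

  Fwd∞-σ : ∀ {x} → Fwd∞ x → Fwd∞ (σ x)
  Fwd∞-σ f∞ n = F.Chain-σ (IsFreeInvolution.closed σ-free) σ-source (f∞ n)

  Level : ℕ → Pred X 0ℓ
  Level k = Fwd∞ ∩ Bwd k

  module _ {b} (Fwd∞-size : HasSize Fwd∞ b) where
    private
      next-choice = choice _⟶_ _⟶?_ Fwd∞-size

    next : X → X
    next = proj₁ next-choice

    next-spec : ∀ {x} → Fwd∞ x → x ⟶ next x × Fwd∞ (next x)
    next-spec f∞ = let y , x⟶y , f∞′ = F.Chain∞-successor source-S forward-determined f∞
                   in swap (proj₂ next-choice f∞′ x⟶y)

    next-unique : ∀ {x y} → Fwd∞ x → x ⟶ y → Fwd∞ y → next x ≡ y
    next-unique f∞ x⟶y f∞′ =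
      sym (forward-determined x⟶y (proj₁ (next-spec f∞)) (f∞′ 2) (proj₂ (next-spec f∞) 2))

    Level-suc : ∀ {k} → Level (suc k) ≐ Image next (Level k)
    Level-suc = (λ (f∞ , x , x⟶y , bₖ) → let f∞ₓ = F.Chain∞-pred source-S x⟶y f∞
                                         in x , (f∞ₓ , bₖ) , next-unique f∞ₓ x⟶y f∞)
              , λ { (x , (f∞ , bₖ) , refl) → proj₂ (next-spec f∞) , x , proj₁ (next-spec f∞) , bₖ }

    Level-size : ∀ {k m} → HasSize (Level k) m → ∃ λ n → HasSize (Level (suc k)) n
    Level-size Sₖ =
      let n , S′ = HasSize-∩ Fwd∞-size (Image? (via-injection ι ℕ._≟_) Sₖ)
      in n , HasSize-cong ((λ (_ , y) → proj₂ Level-suc y) , λ l → proj₁ l , proj₁ Level-suc l) S′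

    halving : ∀ {k m n} → (∀ {x} → Level k x → Level k (σ x)) →
              HasSize (Level k) m → HasSize (Level (suc k)) n → m ≡ 2 * n
    halving Level-σ Sₖ Sₖ₊₁ =
      two-to-one ι (restrict σ-free (λ l → proj₁ l 0) Level-σ) fibres Sₖ (HasSize-cong Level-suc Sₖ₊₁)
      where
      fibres : ∀ {x x′} → Level _ x → Level _ x′ → next x ≡ next x′ ⇔ (x′ ≡ x ⊎ x′ ≡ σ x)
      fibres (f∞ , _) (f∞′ , _) = mk⇔
        (λ e → sources (proj₁ (next-spec f∞)) (subst (_ ⟶_) (sym e) (proj₁ (next-spec f∞′))))
        λ { (inj₁ refl) → refl
          ; (inj₂ refl) →
              sym (next-unique (Fwd∞-σ f∞) (σ-source (proj₁ (next-spec f∞))) (proj₂ (next-spec f∞))) }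

    Level₂≐Fwd∞∩Bwd∞ : Level 2 ≐ Fwd∞ ∩ Bwd∞
    Level₂≐Fwd∞∩Bwd∞ = (λ l → proj₁ l , B.Chain∞-of-closed (λ l → proj₁ l 0) earlier l)
                     , λ (f∞ , b∞) → f∞ , b∞ 2
      where
      earlier : ∀ {x} → Level 2 x → ∃ λ w → w ⟶ x × Level 2 w
      earlier (f∞ , w , w⟶x , b₁) with backward-branch w⟶x b₁
      ... | inj₁ b₂ = w , w⟶x , F.Chain∞-pred source-S w⟶x f∞ , b₂
      ... | inj₂ b₂ = σ w , σ-source w⟶x , Fwd∞-σ (F.Chain∞-pred source-S w⟶x f∞) , b₂

  quarter : ∀ {a b} → HasSize (Fwd∞ ∩ Bwd∞) a → HasSize Fwd∞ b → 4 * a ≡ b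
  quarter {a} {b} C-size Fwd∞-size =
    let n₁ , S₁ = Level-size Fwd∞-size S₀
        n₂ , S₂ = Level-size Fwd∞-size S₁
        b≡2n₁ = halving Fwd∞-size Level₀-σ S₀ S₁
        n₁≡2n₂ = halving Fwd∞-size Level₁-σ S₁ S₂
        n₂≡a = HasSize-unique S₂ C-size (Level₂≐Fwd∞∩Bwd∞ Fwd∞-size)
    in begin
       4 * a           ≡⟨ ℕ.*-assoc 2 2 a ⟩
       2 * (2 * a)     ≡⟨ cong (λ n → 2 * (2 * n)) n₂≡a ⟨
       2 * (2 * n₂)    ≡⟨ cong (2 *_) n₁≡2n₂ ⟨
       2 * n₁          ≡⟨ b≡2n₁ ⟨
       b               ∎
    where
    open ≡-Reasoning
    S₀ : HasSize (Level 0) b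
    S₀ = HasSize-cong ((λ f∞ → f∞ , f∞ 0) , proj₁) Fwd∞-size
    Level₀-σ : ∀ {x} → Level 0 x → Level 0 (σ x)
    Level₀-σ (f∞ , s) = Fwd∞-σ f∞ , IsFreeInvolution.closed σ-free s
    Level₁-σ : ∀ {x} → Level 1 x → Level 1 (σ x)
    Level₁-σ (f∞ , _ , x′⟶x , _) =
      let x″ , x″⟶σx = σ-target x′⟶x in Fwd∞-σ f∞ , x″ , x″⟶σx , source-S x″⟶σx

-- Fields

module FieldProperties {A : Set} (F : Field A) (_≟_ : DecidableEquality A) where
  -- The operations of Field carry no fixity declarations; they are re-exported with the usual ones.
  open Field F renaming (_+_ to infixl 6 _+_; _*_ to infixl 7 _*_; -_ to infix 8 -_)
  open FieldDefs F using (2#) renaming (_-_ to infixl 6 _-_)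

  commutativeRing : CommutativeRing 0ℓ 0ℓ
  commutativeRing = record { isCommutativeRing = isCommutativeRing }

  open CommutativeRing commutativeRing using (*-comm; *-identityˡ; zeroˡ; zeroʳ; -‿inverseʳ; ring)
  open import Algebra.Properties.Ring ring using (-‿involutive; +-inverseˡ-unique; -0#≈0#)
  open IntegerCoefficients commutativeRing
  open ≡-Reasoning

  IsSquare : A → Set
  IsSquare x = ∃ λ y → y * y ≡ x

  1#≢0# : 1# ≢ 0#
  1#≢0# = 0≢1 ∘ sym

  square-* : ∀ a b → a * b * (a * b) ≡ a * a * (b * b)
  square-* = solve 2 (λ a b → a :* b :* (a :* b) := a :* a :* (b :* b)) refl

  difference-of-squares : ∀ a b → (a + b) * (a - b) ≡ a * a - b * b
  difference-of-squares = solve 2 (λ a b → (a :+ b) :* (a :- b) := a :* a :- b :* b) refl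

  -- 0# ⁻¹ = 0# is a junk value.
  _⁻¹ : A → A
  x ⁻¹ with x ≟ 0#
  ... | yes _ = 0#
  ... | no x≢0 = proj₁ (inverse x x≢0)

  x*x⁻¹≡1 : ∀ {x} → x ≢ 0# → x * x ⁻¹ ≡ 1#
  x*x⁻¹≡1 {x} x≢0 with x ≟ 0#
  ... | yes x≡0 = contradiction x≡0 x≢0
  ... | no x≢0 = proj₂ (inverse x x≢0)

  *-cancelˡ : ∀ {a b c} → a ≢ 0# → a * b ≡ a * c → b ≡ c
  *-cancelˡ {a} {b} {c} a≢0 ab≡ac = begin
    b                ≡⟨ *-identityˡ b ⟨
    1# * b           ≡⟨ cong (_* b) (x*x⁻¹≡1 a≢0) ⟨
    a * a ⁻¹ * b     ≡⟨ reassociate a (a ⁻¹) b ⟩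
    a ⁻¹ * (a * b)   ≡⟨ cong (a ⁻¹ *_) ab≡ac ⟩
    a ⁻¹ * (a * c)   ≡⟨ reassociate a (a ⁻¹) c ⟨
    a * a ⁻¹ * c     ≡⟨ cong (_* c) (x*x⁻¹≡1 a≢0) ⟩
    1# * c           ≡⟨ *-identityˡ c ⟩
    c                ∎
    where
    reassociate : ∀ a a′ b → a * a′ * b ≡ a′ * (a * b)
    reassociate = solve 3 (λ a a′ b → a :* a′ :* b := a′ :* (a :* b)) refl

  *-≢0 : ∀ {a b} → a ≢ 0# → b ≢ 0# → a * b ≢ 0#
  *-≢0 {a} a≢0 b≢0 ab≡0 = b≢0 (*-cancelˡ a≢0 (trans ab≡0 (sym (zeroʳ a))))

  *-≢0⁻¹ : ∀ {a b} → a * b ≢ 0# → a ≢ 0# × b ≢ 0#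
  *-≢0⁻¹ {a} {b} ab≢0 = (λ { refl → ab≢0 (zeroˡ b) }) , (λ { refl → ab≢0 (zeroʳ a) })

  *-≡0 : ∀ {a b} → a * b ≡ 0# → a ≡ 0# ⊎ b ≡ 0#
  *-≡0 {a} ab≡0 with a ≟ 0#
  ... | yes a≡0 = inj₁ a≡0
  ... | no a≢0 = inj₂ (*-cancelˡ a≢0 (trans ab≡0 (sym (zeroʳ a))))

  -≢0 : ∀ {a} → a ≢ 0# → - a ≢ 0#
  -≢0 {a} a≢0 -a≡0 = a≢0 (trans (sym (-‿involutive a)) (trans (cong -_ -a≡0) -0#≈0#))

  -x≢x : 2# ≢ 0# → ∀ {x} → x ≢ 0# → - x ≢ x
  -x≢x 2≢0 {x} x≢0 -x≡x = [ 2≢0 , x≢0 ]′ (*-≡0 (begin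
    2# * x     ≡⟨ double x ⟩
    x + x      ≡⟨ cong (x +_) -x≡x ⟨
    x - x      ≡⟨ -‿inverseʳ x ⟩
    0#         ∎))
    where
    double : ∀ x → 2# * x ≡ x + x
    double = solve 1 (λ x → :2 :* x := x :+ x) refl

  x-y≡0⇒x≡y : ∀ {x y} → x - y ≡ 0# → x ≡ y
  x-y≡0⇒x≡y {x} {y} x-y≡0 = trans (+-inverseˡ-unique x (- y) x-y≡0) (-‿involutive y)

  square-roots : ∀ {y z} → y * y ≡ z * z → y ≡ z ⊎ y ≡ - z
  square-roots {y} {z} y²≡z² =
    [ inj₂ ∘ +-inverseˡ-unique y z , inj₁ ∘ x-y≡0⇒x≡y ]′ (*-≡0 (begin
      (y + z) * (y - z)  ≡⟨ difference-of-squares y z ⟩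
      y * y - z * z      ≡⟨ cong (_- z * z) y²≡z² ⟩
      z * z - z * z      ≡⟨ -‿inverseʳ (z * z) ⟩
      0#                 ∎))

  root-≢0 : ∀ {y x} → y * y ≡ x → x ≢ 0# → y ≢ 0#
  root-≢0 y²≡x x≢0 refl = x≢0 (trans (sym y²≡x) (zeroˡ 0#))

  ⁻¹-unique : ∀ {x y} → x * y ≡ 1# → x ⁻¹ ≡ y
  ⁻¹-unique {x} {y} xy≡1 = *-cancelˡ x≢0 (trans (x*x⁻¹≡1 x≢0) (sym xy≡1))
    where
    x≢0 : x ≢ 0#
    x≢0 x≡0 = 0≢1 (trans (sym (zeroˡ y)) (trans (cong (_* y) (sym x≡0)) xy≡1))

  ⁻¹-≢0 : ∀ {x} → x ≢ 0# → x ⁻¹ ≢ 0#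
  ⁻¹-≢0 {x} x≢0 x⁻¹≡0 =
    0≢1 (trans (sym (zeroʳ x)) (trans (cong (x *_) (sym x⁻¹≡0)) (x*x⁻¹≡1 x≢0)))

  ⁻¹-involutive : ∀ {x} → x ≢ 0# → x ⁻¹ ⁻¹ ≡ x
  ⁻¹-involutive {x} x≢0 = ⁻¹-unique (trans (*-comm (x ⁻¹) x) (x*x⁻¹≡1 x≢0))

  ¬IsSquare⇒≢0 : ∀ {a} → ¬ IsSquare a → a ≢ 0#
  ¬IsSquare⇒≢0 ¬□a refl = ¬□a (0# , zeroˡ 0#)

  IsSquare-* : ∀ {a b} → IsSquare a → IsSquare b → IsSquare (a * b)
  IsSquare-* (s , refl) (t , refl) = s * t , square-* s t

  IsSquare-cancelˡ : ∀ {c b} → c ≢ 0# → IsSquare (c * c * b) → IsSquare b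
  IsSquare-cancelˡ {c} {b} c≢0 (t , t²≡c²b) = t * c ⁻¹ , (begin
    t * c ⁻¹ * (t * c ⁻¹)                 ≡⟨ square-* t (c ⁻¹) ⟩
    t * t * (c ⁻¹ * c ⁻¹)                 ≡⟨ cong (_* (c ⁻¹ * c ⁻¹)) t²≡c²b ⟩
    c * c * b * (c ⁻¹ * c ⁻¹)             ≡⟨ pair-off c (c ⁻¹) b ⟩
    c * c ⁻¹ * (c * c ⁻¹) * b             ≡⟨ cong (λ u → u * u * b) (x*x⁻¹≡1 c≢0) ⟩
    1# * 1# * b                           ≡⟨ cong (_* b) (*-identityˡ 1#) ⟩
    1# * b                                ≡⟨ *-identityˡ b ⟩
    b                                     ∎)
    where
    pair-off : ∀ c c′ b → c * c * b * (c′ * c′) ≡ c * c′ * (c * c′) * b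
    pair-off = solve 3 (λ c c′ b → c :* c :* b :* (c′ :* c′) := c :* c′ :* (c :* c′) :* b) refl

-- Square classes of a finite field of order q ≡ 5 (mod 8)

module FiniteFieldArithmetic {q : ℕ} (F : Field (Fin q)) where
  open Field F renaming (_+_ to infixl 6 _+_; _*_ to infixl 7 _*_; -_ to infix 8 -_)
  open FieldDefs F using (2#) renaming (_-_ to infixl 6 _-_)
  open FieldProperties F Fin._≟_
  open CommutativeRing commutativeRing using (+-assoc; +-identityʳ; *-comm; *-identityˡ; -‿inverseʳ; ring)
  open import Algebra.Properties.Ring ring using (-‿involutive; -1*x≈-x)
  open IntegerCoefficients commutativeRing
  open ≡-Reasoning

  private
    variable
      P : Pred (Fin q) 0ℓ
      m n : ℕ

  toℕ-↣ : Fin q ↣ ℕ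
  toℕ-↣ = mk↣ Fin.toℕ-injective

  everything : HasSize U q
  everything = allFin q , Unique.allFin⁺ q , (λ x → mk⇔ _ (λ _ → ∈-allFin x)) , length-tabulate id

  Nonzero : Pred (Fin q) 0ℓ
  Nonzero x = x ≢ 0#

  SquaresOf : Pred (Fin q) 0ℓ → Pred (Fin q) 0ℓ
  SquaresOf = Image (λ y → y * y)

  Squares : Pred (Fin q) 0ℓ
  Squares = SquaresOf Nonzero

  IsSquare? : Decidable IsSquare
  IsSquare? x =
    map′ (λ (y , _ , y²≡x) → y , y²≡x) (λ (y , y²≡x) → y , tt , y²≡x) (Image? Fin._≟_ everything x)

  SquaresOf-size : HasSize P m → ∃ λ n → HasSize (SquaresOf P) n
  SquaresOf-size S = HasSize-decidable everything (Image? Fin._≟_ S)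

  Nonzero-size : q ≡ suc n → HasSize Nonzero n
  Nonzero-size q≡1+n =
    let n′ , S , q≡1+n′ = HasSize-remove Fin._≟_ everything tt
    in subst (HasSize Nonzero) (ℕ.suc-injective (trans (sym q≡1+n′) q≡1+n))
             (HasSize-cong (proj₂ , (tt ,_)) S)

  SquaresOf-⊆ : P ⊆ Nonzero → SquaresOf P ⊆ Nonzero
  SquaresOf-⊆ P⊆Nonzero (y , p , refl) = *-≢0 (P⊆Nonzero p) (P⊆Nonzero p)

  SquaresOf-⁻¹ : P ⊆ Nonzero → (∀ {x} → P x → P (x ⁻¹)) →
                 ∀ {x} → SquaresOf P x → SquaresOf P (x ⁻¹)
  SquaresOf-⁻¹ P⊆Nonzero P-⁻¹ (y , p , refl) = y ⁻¹ , P-⁻¹ p , sym (⁻¹-unique (begin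
    y * y * (y ⁻¹ * y ⁻¹)       ≡⟨ square-* y (y ⁻¹) ⟨
    y * y ⁻¹ * (y * y ⁻¹)       ≡⟨ cong (λ u → u * u) (x*x⁻¹≡1 (P⊆Nonzero p)) ⟩
    1# * 1#                     ≡⟨ *-identityˡ 1# ⟩
    1#                          ∎))

  squaring-halves : 2# ≢ 0# → P ⊆ Nonzero → (∀ {x} → P x → P (- x)) →
                    HasSize P m → HasSize (SquaresOf P) n → m ≡ 2 ℕ.* n
  squaring-halves 2≢0 P⊆Nonzero P-neg = two-to-one toℕ-↣ negation-free fibres
    where
    negation-free : IsFreeInvolution _ (-_)
    negation-free = record
      { closed = P-neg
      ; involutive = λ _ → -‿involutive _
      ; no-fixed-point = -x≢x 2≢0 ∘ P⊆Nonzero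
      }
    neg-square : ∀ x → - x * - x ≡ x * x
    neg-square = solve 1 (λ x → :- x :* :- x := x :* x) refl
    fibres : ∀ {x x′} → _ → _ → x * x ≡ x′ * x′ ⇔ (x′ ≡ x ⊎ x′ ≡ - x)
    fibres _ _ = mk⇔ (square-roots ∘ sym) λ { (inj₁ refl) → refl ; (inj₂ refl) → sym (neg-square _) }

  -- x ↦ x ⁻¹ is a fixed-point-free involution of P ∖ {1, −1}.
  module InversionParity (P⊆Nonzero : P ⊆ Nonzero) (P-⁻¹ : ∀ {x} → P x → P (x ⁻¹)) (1∈P : P 1#)
                         (S : HasSize P m) where
    private
      -1*-1≡1 : - 1# * - 1# ≡ 1#
      -1*-1≡1 = solve 0 (:- :1 :* :- :1 := :1) refl

      inversion-free : ∀ {Q} → Q ⊆ P → (∀ {x} → Q x → Q (x ⁻¹)) →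
                       (∀ {x} → Q x → x ≢ 1# × x ≢ - 1#) → IsFreeInvolution Q _⁻¹
      inversion-free Q⊆P Q-⁻¹ Q≢±1 = record
        { closed = Q-⁻¹
        ; involutive = ⁻¹-involutive ∘ P⊆Nonzero ∘ Q⊆P
        ; no-fixed-point = λ {x} q x⁻¹≡x →
            [ proj₁ (Q≢±1 q) , proj₂ (Q≢±1 q) ]′ (square-roots (begin
              x * x        ≡⟨ cong (x *_) x⁻¹≡x ⟨
              x * x ⁻¹     ≡⟨ x*x⁻¹≡1 (P⊆Nonzero (Q⊆P q)) ⟩
              1#           ≡⟨ *-identityˡ 1# ⟨
              1# * 1#      ∎))
        }

      ⁻¹-≢ : ∀ {x y} → P x → y * y ≡ 1# → x ≢ y → x ⁻¹ ≢ y
      ⁻¹-≢ p y²≡1 x≢y x⁻¹≡y =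
        x≢y (trans (sym (⁻¹-involutive (P⊆Nonzero p))) (trans (cong _⁻¹ x⁻¹≡y) (⁻¹-unique y²≡1)))

    parity-without-−1 : ¬ P (- 1#) → ∃ λ a → m ≡ suc (2 ℕ.* a)
    parity-without-−1 -1∉P =
      let n , S₁ , m≡1+n = HasSize-remove Fin._≟_ S 1∈P
          a , n≡2a = even-size toℕ-↣ (inversion-free proj₁
                       (λ (p , x≢1) → P-⁻¹ p , ⁻¹-≢ p (*-identityˡ 1#) x≢1)
                       (λ (p , x≢1) → x≢1 , λ { refl → -1∉P p })) S₁
      in a , trans m≡1+n (cong suc n≡2a)

    parity-with-−1 : 2# ≢ 0# → P (- 1#) → ∃ λ a → m ≡ 2 ℕ.+ 2 ℕ.* a
    parity-with-−1 2≢0 -1∈P =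
      let n , S₁ , m≡1+n = HasSize-remove Fin._≟_ S 1∈P
          n′ , S₂ , n≡1+n′ = HasSize-remove Fin._≟_ S₁ (-1∈P , -x≢x 2≢0 1#≢0#)
          a , n′≡2a = even-size toℕ-↣ (inversion-free (proj₁ ∘ proj₁)
                        (λ ((p , x≢1) , x≢-1) →
                          (P-⁻¹ p , ⁻¹-≢ p (*-identityˡ 1#) x≢1) , ⁻¹-≢ p -1*-1≡1 x≢-1)
                        (λ ((_ , x≢1) , x≢-1) → x≢1 , x≢-1)) S₂
      in a , trans m≡1+n (cong suc (trans n≡1+n′ (cong suc n′≡2a)))

  private
    1∈Squares : Squares 1#
    1∈Squares = 1# , 1#≢0# , *-identityˡ 1#

    Squares-⁻¹ : ∀ {x} → Squares x → Squares (x ⁻¹)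
    Squares-⁻¹ = SquaresOf-⁻¹ id ⁻¹-≢0

  Squares-neg : IsSquare (- 1#) → ∀ {x} → Squares x → Squares (- x)
  Squares-neg (j , j²≡-1) (y , y≢0 , refl) = j * y , *-≢0 (root-≢0 j²≡-1 (-≢0 1#≢0#)) y≢0 , (begin
    j * y * (j * y)   ≡⟨ square-* j y ⟩
    j * j * (y * y)   ≡⟨ cong (_* (y * y)) j²≡-1 ⟩
    - 1# * (y * y)    ≡⟨ -1*x≈-x (y * y) ⟩
    - (y * y)         ∎)

  module OddOrder (n : ℕ) (q≡1+2n : q ≡ suc (2 ℕ.* n)) where

    2#≢0# : 2# ≢ 0#
    2#≢0# 2≡0 =
      let a , q≡2a = even-size toℕ-↣ translation-free everything
      in ℕ.even≢odd a n (trans (sym q≡2a) q≡1+2n)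
      where
      translation-free : IsFreeInvolution U (_+ 1#)
      translation-free = record
        { closed = λ _ → tt
        ; involutive = λ {x} _ → trans (+-assoc x 1# 1#) (trans (cong (x +_) 2≡0) (+-identityʳ x))
        ; no-fixed-point = λ {x} _ x+1≡x → 1#≢0# (begin
            1#            ≡⟨ cancel x ⟩
            x + 1# - x    ≡⟨ cong (_- x) x+1≡x ⟩
            x - x         ≡⟨ -‿inverseʳ x ⟩
            0#            ∎)
        }
        where
        cancel : ∀ x → 1# ≡ x + 1# - x
        cancel = solve 1 (λ x → :1 := x :+ :1 :- x) refl

    squares-count : ∀ {s} → HasSize Squares s → s ≡ n
    squares-count {s} S = sym (ℕ.*-cancelˡ-≡ n s 2
      (squaring-halves 2#≢0# id (-≢0) (Nonzero-size q≡1+2n) S))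

    nonsquares-count : ∀ {c} → HasSize (Nonzero ∩ ∁ IsSquare) c → c ≡ n
    nonsquares-count {c} C =
      let s , S = HasSize-∩ (Nonzero-size q≡1+2n) IsSquare?
          s≡n = squares-count (HasSize-cong
                  ( (λ (x≢0 , y , y²≡x) → y , root-≢0 y²≡x x≢0 , y²≡x)
                  , (λ (y , y≢0 , y²≡x) → subst Nonzero y²≡x (*-≢0 y≢0 y≢0) , y , y²≡x)) S)
          2n≡s+c = HasSize-partition IsSquare? (Nonzero-size q≡1+2n) S C
      in ℕ.+-cancelˡ-≡ n c n (begin
           n ℕ.+ c        ≡⟨ cong (ℕ._+ c) s≡n ⟨
           s ℕ.+ c        ≡⟨ 2n≡s+c ⟨
           2 ℕ.* n        ≡⟨ cong (n ℕ.+_) (ℕ.+-identityʳ n) ⟩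
           n ℕ.+ n        ∎)

    -- Multiplication by a maps the squares into the equally many non-squares, hence onto them.
    nonsquare-product : ∀ {a b} → ¬ IsSquare a → ¬ IsSquare b → IsSquare (a * b)
    nonsquare-product {a} {b} ¬□a ¬□b =
      let s , S = SquaresOf-size (Nonzero-size q≡1+2n)
          c , C = HasSize-∩ (Nonzero-size q≡1+2n) (¬? ∘ IsSquare?)
          c≡s = trans (nonsquares-count C) (sym (squares-count S))
          z , (y , _ , y²≡z) , az≡b =
            HasSize-⊆⇒⊇ (Image? Fin._≟_ S) (HasSize-image (λ _ _ → *-cancelˡ a≢0) S) (subst (HasSize _) c≡s C)
                         a·Squares⊆Nonsquares (¬IsSquare⇒≢0 ¬□b , ¬□b)
      in a * y , (begin
           a * y * (a * y)     ≡⟨ regroup a y ⟩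
           a * (a * (y * y))   ≡⟨ cong (λ u → a * (a * u)) y²≡z ⟩
           a * (a * z)         ≡⟨ cong (a *_) az≡b ⟩
           a * b               ∎)
      where
      a≢0 = ¬IsSquare⇒≢0 ¬□a
      a·Squares⊆Nonsquares : Image (a *_) Squares ⊆ Nonzero ∩ ∁ IsSquare
      a·Squares⊆Nonsquares (_ , (y , y≢0 , refl) , refl) =
        *-≢0 a≢0 (*-≢0 y≢0 y≢0) ,
        λ □ → ¬□a (IsSquare-cancelˡ y≢0 (subst IsSquare (*-comm a (y * y)) □))
      regroup : ∀ a y → a * y * (a * y) ≡ a * (a * (y * y))
      regroup = solve 2 (λ a y → a :* y :* (a :* y) := a :* (a :* (y :* y))) refl

  -- There are (q − 1)/2 nonzero squares, an even number.
  -1-square : q ≡ suc (2 ℕ.* (2 ℕ.* m)) → IsSquare (- 1#)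
  -1-square {m} q≡1+4m = decidable-stable (IsSquare? (- 1#)) λ ¬□ →
    let s , S = SquaresOf-size (Nonzero-size q≡1+4m)
        a , s≡1+2a = InversionParity.parity-without-−1 (SquaresOf-⊆ id) Squares-⁻¹ 1∈Squares S
                       (λ (y , _ , y²≡-1) → ¬□ (y , y²≡-1))
    in ℕ.even≢odd m a (trans (sym (squares-count S)) s≡1+2a)
    where open OddOrder (2 ℕ.* m) q≡1+4m

  -- If i = r², then −1 = (r²)² is one of the (q − 1)/4 nonzero fourth powers, an odd number.
  i-nonsquare : ∀ {k} → q ≡ suc (2 ℕ.* (2 ℕ.* suc (2 ℕ.* k))) →
                ∀ {i} → i * i ≡ - 1# → ¬ IsSquare i
  i-nonsquare {k} q≡5+8k {i} i²≡-1 (r , r²≡i) =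
    let s , S = SquaresOf-size (Nonzero-size q≡5+8k)
        t , T = SquaresOf-size S
        a , t≡2+2a = InversionParity.parity-with-−1 (SquaresOf-⊆ (SquaresOf-⊆ id))
                       (SquaresOf-⁻¹ (SquaresOf-⊆ id) Squares-⁻¹) (1# , 1∈Squares , *-identityˡ 1#) T
                       2≢0 (i , (r , root-≢0 r²≡i i≢0 , r²≡i) , i²≡-1)
        s≡2t = squaring-halves 2≢0 (SquaresOf-⊆ id) (Squares-neg (-1-square {suc (2 ℕ.* k)} q≡5+8k)) S T
        t≡1+2k = ℕ.*-cancelˡ-≡ t (suc (2 ℕ.* k)) 2 (trans (sym s≡2t) (squares-count S))
    in ℕ.even≢odd (suc a) k (trans (ℕ.*-distribˡ-+ 2 1 a) (trans (sym t≡2+2a) t≡1+2k))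
    where
    open OddOrder (2 ℕ.* suc (2 ℕ.* k)) q≡5+8k renaming (2#≢0# to 2≢0)
    i≢0 = root-≢0 i²≡-1 (-≢0 1#≢0#)

-- The midpoint dynamics

module MidpointDynamics {A : Set} (F : Field A) (_≟_ : DecidableEquality A) where
  open Field F using (0#; 1#) renaming (_+_ to infixl 6 _+_; _*_ to infixl 7 _*_; -_ to infix 8 -_)
  open FieldDefs F using (2#; S; _↦_) renaming (_-_ to infixl 6 _-_)
  open FieldProperties F _≟_
  open CommutativeRing commutativeRing using (+-comm; *-comm; *-identityʳ; -‿inverseʳ; ring)
  open import Algebra.Properties.Ring ring
    using (-‿involutive; -0#≈0#; -1*x≈-x; -‿distribʳ-*; ⁻¹-anti-homo‿-)
  open IntegerCoefficients commutativeRing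
  open ≡-Reasoning

  private
    cancelˡ : ∀ a b → a + b - a ≡ b
    cancelˡ = solve 2 (λ a b → a :+ b :- a := b) refl

  neg₂ : A × A → A × A
  neg₂ (a , b) = a , - b

  S? : Decidable S
  S? (a , b) = ¬? (a ≟ 0#) ×-dec ¬? (b ≟ 0#) ×-dec ¬? ((a + b) ≟ 0#) ×-dec ¬? ((a - b) ≟ 0#)

  _↦?_ : ∀ x y → Dec (x ↦ y)
  (α , β) ↦? (γ , δ) =
    S? (α , β) ×-dec S? (γ , δ) ×-dec ((2# * γ) ≟ (α + β)) ×-dec ((δ * δ) ≟ (α * β))

  S-swap : ∀ {a b} → S (a , b) → S (b , a)
  S-swap {a} {b} (a≢0 , b≢0 , a+b≢0 , a-b≢0) =
    b≢0 , a≢0 , a+b≢0 ∘ trans (+-comm a b) , λ b-a≡0 → a-b≢0 (begin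
      a - b        ≡⟨ ⁻¹-anti-homo‿- b a ⟨
      - (b - a)    ≡⟨ cong -_ b-a≡0 ⟩
      - 0#         ≡⟨ -0#≈0# ⟩
      0#           ∎)

  S-neg : ∀ {a b} → S (a , b) → S (a , - b)
  S-neg {a} {b} (a≢0 , b≢0 , a+b≢0 , a-b≢0) =
    a≢0 , -≢0 b≢0 , a-b≢0 , a+b≢0 ∘ trans (cong (a +_) (sym (-‿involutive b)))

  S⇒α²-β²≢0 : ∀ {α β} → S (α , β) → α * α - β * β ≢ 0#
  S⇒α²-β²≢0 {α} {β} (_ , _ , α+β≢0 , α-β≢0) =
    subst (_≢ 0#) (difference-of-squares α β) (*-≢0 α+β≢0 α-β≢0)

  swap-free : IsFreeInvolution S swap
  swap-free = record
    { closed = S-swap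
    ; involutive = λ _ → refl
    ; no-fixed-point = λ { {a , b} (_ , _ , _ , a-b≢0) b,a≡a,b → a-b≢0 (begin
        a - b     ≡⟨ cong (_- b) (cong proj₂ b,a≡a,b) ⟩
        b - b     ≡⟨ -‿inverseʳ b ⟩
        0#        ∎) }
    }

  ↦-swap : ∀ {x y} → x ↦ y → swap x ↦ y
  ↦-swap {α , β} (s , t , 2γ≡α+β , δ²≡αβ) =
    S-swap s , t , trans 2γ≡α+β (+-comm α β) , trans δ²≡αβ (*-comm α β)

  ↦-neg : ∀ {x y} → x ↦ y → x ↦ neg₂ y
  ↦-neg {y = γ , δ} (s , t , 2γ≡α+β , δ²≡αβ) = s , S-neg t , 2γ≡α+β , trans (neg-square δ) δ²≡αβ
    where
    neg-square : ∀ δ → - δ * - δ ≡ δ * δ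
    neg-square = solve 1 (λ δ → :- δ :* :- δ := δ :* δ) refl

  sources : ∀ {x x′ y} → x ↦ y → x′ ↦ y → x′ ≡ x ⊎ x′ ≡ swap x
  sources {α , β} {α′ , β′} (_ , _ , 2γ≡α+β , δ²≡αβ) (_ , _ , 2γ≡α′+β′ , δ²≡α′β′) =
    Sum.map (λ α′-α≡0 → let α′≡α = x-y≡0⇒x≡y α′-α≡0
                        in cong₂ _,_ α′≡α (trans (β′≡ α′≡α) (cancelˡ α β)))
            (λ α′-β≡0 → let α′≡β = x-y≡0⇒x≡y α′-β≡0
                        in cong₂ _,_ α′≡β (trans (β′≡ α′≡β) (cancelʳ α β)))
            (*-≡0 (begin
      (α′ - α) * (α′ - β)                  ≡⟨ expand α′ α β ⟩
      α′ * α′ - α′ * (α + β) + α * β       ≡⟨ cong₂ (λ u v → α′ * α′ - α′ * u + v) sum product ⟨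
      α′ * α′ - α′ * (α′ + β′) + α′ * β′   ≡⟨ vanish α′ β′ ⟩
      0#                                   ∎))
    where
    sum : α′ + β′ ≡ α + β
    sum = trans (sym 2γ≡α′+β′) 2γ≡α+β
    product : α′ * β′ ≡ α * β
    product = trans (sym δ²≡α′β′) δ²≡αβ
    expand : ∀ α′ α β → (α′ - α) * (α′ - β) ≡ α′ * α′ - α′ * (α + β) + α * β
    expand = solve 3 (λ α′ α β → (α′ :- α) :* (α′ :- β)
                               := α′ :* α′ :- α′ :* (α :+ β) :+ α :* β) refl
    vanish : ∀ α′ β′ → α′ * α′ - α′ * (α′ + β′) + α′ * β′ ≡ 0#
    vanish = solve 2 (λ α′ β′ → α′ :* α′ :- α′ :* (α′ :+ β′) :+ α′ :* β′ := con (ℤ.+ 0)) refl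
    cancelʳ : ∀ a b → a + b - b ≡ a
    cancelʳ = solve 2 (λ a b → a :+ b :- b := a) refl
    β′≡ : ∀ {a} → α′ ≡ a → β′ ≡ α + β - a
    β′≡ {a} α′≡a = begin
      β′                ≡⟨ cancelˡ α′ β′ ⟨
      α′ + β′ - α′      ≡⟨ cong₂ _-_ sum α′≡a ⟩
      α + β - a         ∎

  predecessor-form : ∀ {μ ν α β} → (μ , ν) ↦ (α , β) →
                     ∃ λ e → μ ≡ α + e × ν ≡ α - e × e * e ≡ α * α - β * β
  predecessor-form {μ} {ν} {α} {β} (_ , _ , 2α≡μ+ν , β²≡μν) = μ - α , sym (shift α μ) , (begin
      ν                          ≡⟨ cancelˡ μ ν ⟨
      μ + ν - μ                  ≡⟨ cong (_- μ) 2α≡μ+ν ⟨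
      2# * α - μ                 ≡⟨ reflect α μ ⟩
      α - (μ - α)                ∎) , (begin
      (μ - α) * (μ - α)          ≡⟨ complete-square μ α ⟩
      α * α - μ * (2# * α - μ)   ≡⟨ cong (λ u → α * α - μ * (u - μ)) 2α≡μ+ν ⟩
      α * α - μ * (μ + ν - μ)    ≡⟨ cong (λ u → α * α - μ * u) (cancelˡ μ ν) ⟩
      α * α - μ * ν              ≡⟨ cong (λ u → α * α - u) β²≡μν ⟨
      α * α - β * β              ∎)
    where
    shift : ∀ α μ → α + (μ - α) ≡ μ
    shift = solve 2 (λ α μ → α :+ (μ :- α) := μ) refl
    reflect : ∀ α μ → 2# * α - μ ≡ α - (μ - α)
    reflect = solve 2 (λ α μ → :2 :* α :- μ := α :- (μ :- α)) refl
    complete-square : ∀ μ α → (μ - α) * (μ - α) ≡ α * α - μ * (2# * α - μ)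
    complete-square = solve 2 (λ μ α → (μ :- α) :* (μ :- α)
                                     := α :* α :- μ :* (:2 :* α :- μ)) refl

  module _ (2≢0 : 2# ≢ 0#) where

    neg-free : IsFreeInvolution S neg₂
    neg-free = record
      { closed = S-neg
      ; involutive = λ _ → cong (_ ,_) (-‿involutive _)
      ; no-fixed-point = λ (_ , b≢0 , _) e → -x≢x 2≢0 b≢0 (cong proj₂ e)
      }

    half : A → A
    half x = x * 2# ⁻¹

    2*half : ∀ x → 2# * half x ≡ x
    2*half x = begin
      2# * (x * 2# ⁻¹)   ≡⟨ regroup 2# x (2# ⁻¹) ⟩
      x * (2# * 2# ⁻¹)   ≡⟨ cong (x *_) (x*x⁻¹≡1 2≢0) ⟩
      x * 1#             ≡⟨ *-identityʳ x ⟩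
      x                  ∎
      where
      regroup : ∀ a x a′ → a * (x * a′) ≡ x * (a * a′)
      regroup = solve 3 (λ a x a′ → a :* (x :* a′) := x :* (a :* a′)) refl

    ↦-intro : ∀ {α β γ ρ} → S (α , β) → 2# * γ ≡ α + β → ρ * ρ ≡ α * β → (α , β) ↦ (γ , ρ)
    ↦-intro {α} {β} {γ} {ρ} s@(α≢0 , β≢0 , α+β≢0 , α-β≢0) 2γ≡α+β ρ²≡αβ =
      s , (proj₂ (*-≢0⁻¹ (subst (_≢ 0#) (sym 2γ≡α+β) α+β≢0)) , root-≢0 ρ²≡αβ (*-≢0 α≢0 β≢0) ,
           proj₂ (*-≢0⁻¹ (proj₁ 2[γ+ρ]2[γ-ρ]≢0)) , proj₂ (*-≢0⁻¹ (proj₂ 2[γ+ρ]2[γ-ρ]≢0))) ,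
      2γ≡α+β , ρ²≡αβ
      where
      key : (α - β) * (α - β) ≡ 2# * (γ + ρ) * (2# * (γ - ρ))
      key = begin
        (α - β) * (α - β)                            ≡⟨ expand α β ⟩
        (α + β) * (α + β) - 2# * 2# * (α * β)        ≡⟨ cong₂ (λ u v → u * u - 2# * 2# * v) 2γ≡α+β ρ²≡αβ ⟨
        2# * γ * (2# * γ) - 2# * 2# * (ρ * ρ)        ≡⟨ factor γ ρ ⟩
        2# * (γ + ρ) * (2# * (γ - ρ))                ∎
        where
        expand : ∀ α β → (α - β) * (α - β) ≡ (α + β) * (α + β) - 2# * 2# * (α * β)
        expand = solve 2 (λ α β → (α :- β) :* (α :- β)
                                := (α :+ β) :* (α :+ β) :- :2 :* :2 :* (α :* β)) refl
        factor : ∀ γ ρ → 2# * γ * (2# * γ) - 2# * 2# * (ρ * ρ) ≡ 2# * (γ + ρ) * (2# * (γ - ρ))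
        factor = solve 2 (λ γ ρ → :2 :* γ :* (:2 :* γ) :- :2 :* :2 :* (ρ :* ρ)
                                := :2 :* (γ :+ ρ) :* (:2 :* (γ :- ρ))) refl
      2[γ+ρ]2[γ-ρ]≢0 : 2# * (γ + ρ) ≢ 0# × 2# * (γ - ρ) ≢ 0#
      2[γ+ρ]2[γ-ρ]≢0 = *-≢0⁻¹ (subst (_≢ 0#) key (*-≢0 α-β≢0 α-β≢0))

    ↦-intro⁻ : ∀ {γ δ e} → S (γ , δ) → e * e ≡ γ * γ - δ * δ → (γ + e , γ - e) ↦ (γ , δ)
    ↦-intro⁻ {γ} {δ} {e} s@(γ≢0 , δ≢0 , _) e²≡γ²-δ² =
      ( proj₁ (*-≢0⁻¹ [γ+e][γ-e]≢0)
      , proj₂ (*-≢0⁻¹ [γ+e][γ-e]≢0)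
      , subst (_≢ 0#) (sym (sum γ e)) (*-≢0 2≢0 γ≢0)
      , subst (_≢ 0#) (sym (difference γ e)) (*-≢0 2≢0 (root-≢0 e²≡γ²-δ² (S⇒α²-β²≢0 s))) ) ,
      s , sym (sum γ e) , sym product
      where
      sum : ∀ γ e → γ + e + (γ - e) ≡ 2# * γ
      sum = solve 2 (λ γ e → γ :+ e :+ (γ :- e) := :2 :* γ) refl
      difference : ∀ γ e → γ + e - (γ - e) ≡ 2# * e
      difference = solve 2 (λ γ e → γ :+ e :- (γ :- e) := :2 :* e) refl
      product : (γ + e) * (γ - e) ≡ δ * δ
      product = begin
        (γ + e) * (γ - e)          ≡⟨ difference-of-squares γ e ⟩
        γ * γ - e * e              ≡⟨ cong (λ u → γ * γ - u) e²≡γ²-δ² ⟩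
        γ * γ - (γ * γ - δ * δ)    ≡⟨ cancel γ δ ⟩
        δ * δ                      ∎
        where
        cancel : ∀ γ δ → γ * γ - (γ * γ - δ * δ) ≡ δ * δ
        cancel = solve 2 (λ γ δ → γ :* γ :- (γ :* γ :- δ :* δ) := δ :* δ) refl
      [γ+e][γ-e]≢0 : (γ + e) * (γ - e) ≢ 0#
      [γ+e][γ-e]≢0 = subst (_≢ 0#) (sym product) (*-≢0 δ≢0 δ≢0)

    targets : ∀ {x y y′} → x ↦ y → x ↦ y′ → y′ ≡ y ⊎ y′ ≡ neg₂ y
    targets (_ , _ , 2γ≡α+β , δ²≡αβ) (_ , _ , 2γ′≡α+β , δ′²≡αβ) =
      Sum.map (cong₂ _,_ γ′≡γ) (cong₂ _,_ γ′≡γ) (square-roots (trans δ′²≡αβ (sym δ²≡αβ)))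
      where
      γ′≡γ = *-cancelˡ 2≢0 (trans 2γ′≡α+β (sym 2γ≡α+β))

    module _ {i : A} (i²≡-1 : i * i ≡ - 1#) (i-nonsquare : ¬ IsSquare i) where
      open Chains _↦_ S using () renaming (Chain to Fwd)
      open Chains (flip _↦_) S using () renaming (Chain to Bwd)

      i-square : ∀ x → i * x * (i * x) ≡ - (x * x)
      i-square x = begin
        i * x * (i * x)     ≡⟨ square-* i x ⟩
        i * i * (x * x)     ≡⟨ cong (_* (x * x)) i²≡-1 ⟩
        - 1# * (x * x)      ≡⟨ -1*x≈-x (x * x) ⟩
        - (x * x)           ∎

      i-root : ∀ {ρ γ δ} → ρ * ρ ≡ γ * δ → i * ρ * (i * ρ) ≡ γ * - δ
      i-root {ρ} {γ} {δ} ρ²≡γδ = begin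
        i * ρ * (i * ρ)      ≡⟨ i-square ρ ⟩
        - (ρ * ρ)            ≡⟨ cong -_ ρ²≡γδ ⟩
        - (γ * δ)            ≡⟨ -‿distribʳ-* γ δ ⟩
        γ * - δ              ∎

      i-root⁻ : ∀ {e γ δ} → e * e ≡ γ * γ - δ * δ → i * e * (i * e) ≡ δ * δ - γ * γ
      i-root⁻ {e} {γ} {δ} e²≡γ²-δ² = begin
        i * e * (i * e)        ≡⟨ i-square e ⟩
        - (e * e)              ≡⟨ cong -_ e²≡γ²-δ² ⟩
        - (γ * γ - δ * δ)      ≡⟨ ⁻¹-anti-homo‿- (γ * γ) (δ * δ) ⟩
        δ * δ - γ * γ          ∎

      σ-predecessor : ∀ {γ δ e} → S (γ , δ) → e * e ≡ γ * γ - δ * δ →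
                      (δ + i * e , δ - i * e) ↦ (δ , γ)
      σ-predecessor s e²≡γ²-δ² = ↦-intro⁻ (S-swap s) (i-root⁻ e²≡γ²-δ²)

      τ-successor : ∀ {γ δ z} → (γ , δ) ↦ z → (γ , - δ) ↦ (half (γ - δ) , i * proj₂ z)
      τ-successor {γ} {δ} (s , _ , _ , ρ²≡γδ) = ↦-intro (S-neg s) (2*half (γ - δ)) (i-root ρ²≡γδ)

      IsSquare-sign : ∀ {a t t′} → t′ ≡ t ⊎ t′ ≡ - t → IsSquare (a * t′) → IsSquare (a * t)
      IsSquare-sign (inj₁ refl) □ = □
      IsSquare-sign {a} {t} (inj₂ refl) □ = subst IsSquare (begin
        i * i * (a * - t)    ≡⟨ cong (_* (a * - t)) i²≡-1 ⟩
        - 1# * (a * - t)     ≡⟨ cancel-signs a t ⟩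
        a * t                ∎) (IsSquare-* (i , refl) □)
        where
        cancel-signs : ∀ a t → - 1# * (a * - t) ≡ a * t
        cancel-signs = solve 2 (λ a t → :- :1 :* (a :* :- t) := a :* t) refl

      private
        ¬IsSquare-c²i : ∀ {c p} → c ≢ 0# → p ≡ c * c * i → ¬ IsSquare p
        ¬IsSquare-c²i c≢0 p≡c²i □ = i-nonsquare (IsSquare-cancelˡ c≢0 (subst IsSquare p≡c²i □))

        discriminant : ∀ α e → (α + e) * (α + e) - (α - e) * (α - e) ≡ 2# * 2# * (α * e)
        discriminant = solve 2 (λ α e → (α :+ e) :* (α :+ e) :- (α :- e) :* (α :- e)
                                      := :2 :* :2 :* (α :* e)) refl

      forward-classes : ∀ {x γ δ m ρ m′} → x ↦ (γ , δ) → (γ , δ) ↦ (m , ρ) → 2# * m′ ≡ γ - δ →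
                        ¬ IsSquare (m * ρ * (m′ * (i * ρ)))
      forward-classes {α , β} {γ} {δ} {m} {ρ} {m′}
        ((_ , _ , _ , α-β≢0) , _ , 2γ≡α+β , δ²≡αβ) (_ , (_ , ρ≢0 , _) , 2m≡γ+δ , _) 2m′≡γ-δ □ =
        ¬IsSquare-c²i (*-≢0 α-β≢0 ρ≢0) key (IsSquare-* (2# * 2# , refl) □)
        where
        key : 2# * 2# * (2# * 2#) * (m * ρ * (m′ * (i * ρ))) ≡ (α - β) * ρ * ((α - β) * ρ) * i
        key = begin
          2# * 2# * (2# * 2#) * (m * ρ * (m′ * (i * ρ)))        ≡⟨ regroup m m′ ρ i ⟩
          2# * m * (2# * m′) * (2# * 2# * (ρ * ρ) * i)           ≡⟨ cong₂ (λ u v → u * v * (2# * 2# * (ρ * ρ) * i))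
                                                                         2m≡γ+δ 2m′≡γ-δ ⟩
          (γ + δ) * (γ - δ) * (2# * 2# * (ρ * ρ) * i)            ≡⟨ expand γ δ ρ i ⟩
          (2# * γ * (2# * γ) - 2# * 2# * (δ * δ)) * (ρ * ρ * i)   ≡⟨ cong₂ (λ u v → (u * u - 2# * 2# * v) * (ρ * ρ * i))
                                                                         2γ≡α+β δ²≡αβ ⟩
          ((α + β) * (α + β) - 2# * 2# * (α * β)) * (ρ * ρ * i)   ≡⟨ factor α β ρ i ⟩
          (α - β) * ρ * ((α - β) * ρ) * i                        ∎
          where
          regroup : ∀ m m′ ρ i → 2# * 2# * (2# * 2#) * (m * ρ * (m′ * (i * ρ)))
                                 ≡ 2# * m * (2# * m′) * (2# * 2# * (ρ * ρ) * i)
          regroup = solve 4 (λ m m′ ρ i → :2 :* :2 :* (:2 :* :2) :* (m :* ρ :* (m′ :* (i :* ρ)))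
                                        := :2 :* m :* (:2 :* m′) :* (:2 :* :2 :* (ρ :* ρ) :* i)) refl
          expand : ∀ γ δ ρ i → (γ + δ) * (γ - δ) * (2# * 2# * (ρ * ρ) * i)
                               ≡ (2# * γ * (2# * γ) - 2# * 2# * (δ * δ)) * (ρ * ρ * i)
          expand = solve 4 (λ γ δ ρ i → (γ :+ δ) :* (γ :- δ) :* (:2 :* :2 :* (ρ :* ρ) :* i)
                                      := (:2 :* γ :* (:2 :* γ) :- :2 :* :2 :* (δ :* δ)) :* (ρ :* ρ :* i)) refl
          factor : ∀ α β ρ i → ((α + β) * (α + β) - 2# * 2# * (α * β)) * (ρ * ρ * i)
                               ≡ (α - β) * ρ * ((α - β) * ρ) * i
          factor = solve 4 (λ α β ρ i → ((α :+ β) :* (α :+ β) :- :2 :* :2 :* (α :* β)) :* (ρ :* ρ :* i)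
                                      := (α :- β) :* ρ :* ((α :- β) :* ρ) :* i) refl

      backward-classes : ∀ {α β x e} → (α , β) ↦ x → e * e ≡ α * α - β * β →
                         ¬ IsSquare (α * e * (β * (i * e)))
      backward-classes {α} {β} {γ , δ} {e} (s , (_ , δ≢0 , _) , _ , δ²≡αβ) e²≡α²-β² =
        ¬IsSquare-c²i (*-≢0 δ≢0 (root-≢0 e²≡α²-β² (S⇒α²-β²≢0 s))) (begin
          α * e * (β * (i * e))     ≡⟨ regroup α β e i ⟩
          α * β * (e * e) * i       ≡⟨ cong (λ u → u * (e * e) * i) δ²≡αβ ⟨
          δ * δ * (e * e) * i       ≡⟨ cong (_* i) (square-* δ e) ⟨
          δ * e * (δ * e) * i       ∎)
        where
        regroup : ∀ α β e i → α * e * (β * (i * e)) ≡ α * β * (e * e) * i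
        regroup = solve 4 (λ α β e i → α :* e :* (β :* (i :* e)) := α :* β :* (e :* e) :* i) refl

      successor⇒IsSquare : ∀ {m ρ w} → (m , ρ) ↦ w → IsSquare (m * ρ)
      successor⇒IsSquare (_ , _ , _ , r²≡mρ) = _ , r²≡mρ

      IsSquare⇒successor : ∀ {m ρ} → S (m , ρ) → IsSquare (m * ρ) → Fwd 1 (m , ρ)
      IsSquare⇒successor {m} {ρ} s (r , r²≡mρ) = _ , z↦w , proj₁ (proj₂ z↦w)
        where z↦w = ↦-intro s (2*half (m + ρ)) r²≡mρ

      predecessor⇒IsSquare : ∀ {u α e} → u ↦ (α + e , α - e) → IsSquare (α * e)
      predecessor⇒IsSquare {α = α} {e} u↦v =
        let f , _ , _ , f²≡disc = predecessor-form u↦v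
        in IsSquare-cancelˡ 2≢0 (f , trans f²≡disc (discriminant α e))

      IsSquare⇒predecessor : ∀ {α e} → S (α + e , α - e) → IsSquare (α * e) → Bwd 1 (α + e , α - e)
      IsSquare⇒predecessor {α} {e} s (r , r²≡αe) = _ , u↦v , proj₁ u↦v
        where
        u↦v = ↦-intro⁻ s (begin
          2# * r * (2# * r)                          ≡⟨ square-* 2# r ⟩
          2# * 2# * (r * r)                          ≡⟨ cong (2# * 2# *_) r²≡αe ⟩
          2# * 2# * (α * e)                          ≡⟨ discriminant α e ⟨
          (α + e) * (α + e) - (α - e) * (α - e)      ∎)

      forward-exclusive : ∀ {x y} → x ↦ y → Fwd 2 y → Fwd 2 (neg₂ y) → ⊥
      forward-exclusive x↦y (_ , y↦z@(_ , _ , _ , ρ²≡γδ) , _ , z↦w , _)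
                            (_ , (_ , _ , 2m′≡γ-δ , τ²≡-γδ) , _ , z′↦w′ , _) =
        forward-classes x↦y y↦z 2m′≡γ-δ (IsSquare-* (successor⇒IsSquare z↦w)
          (IsSquare-sign (square-roots (trans τ²≡-γδ (sym (i-root ρ²≡γδ))))
                         (successor⇒IsSquare z′↦w′)))

      backward-exclusive : ∀ {w x} → w ↦ x → Bwd 2 w → Bwd 2 (swap w) → ⊥
      backward-exclusive w↦x ((μ , ν) , v↦w , _ , u↦v , _) ((μ′ , ν′) , v′↦w′ , _ , u′↦v′ , _)
        with predecessor-form v↦w | predecessor-form v′↦w′
      ... | e , refl , refl , e²≡α²-β² | e′ , refl , refl , e′²≡β²-α² =
        backward-classes w↦x e²≡α²-β² (IsSquare-* (predecessor⇒IsSquare u↦v)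
          (IsSquare-sign (square-roots (trans e′²≡β²-α² (sym (i-root⁻ e²≡α²-β²))))
                         (predecessor⇒IsSquare u′↦v′)))

      module _ (IsSquare? : Decidable IsSquare)
               (nonsquare-product : ∀ {a b} → ¬ IsSquare a → ¬ IsSquare b → IsSquare (a * b)) where

        one-square : ∀ {a b} → ¬ IsSquare (a * b) → IsSquare a ⊎ IsSquare b
        one-square {a} {b} ¬□ab with IsSquare? a | IsSquare? b
        ... | yes □a | _ = inj₁ □a
        ... | no _ | yes □b = inj₂ □b
        ... | no ¬□a | no ¬□b = contradiction (nonsquare-product ¬□a ¬□b) ¬□ab

        forward-branch : ∀ {x y} → x ↦ y → Fwd 1 y → Fwd 2 y ⊎ Fwd 2 (neg₂ y)
        forward-branch {y = γ , δ} x↦y (z , y↦z , _) =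
          Sum.map (λ □ → z , y↦z , IsSquare⇒successor (proj₁ (proj₂ y↦z)) □)
                  (λ □ → _ , y′↦z′ , IsSquare⇒successor (proj₁ (proj₂ y′↦z′)) □)
                  (one-square (forward-classes x↦y y↦z (2*half (γ - δ))))
          where y′↦z′ = τ-successor y↦z

        backward-branch : ∀ {w x} → w ↦ x → Bwd 1 w → Bwd 2 w ⊎ Bwd 2 (swap w)
        backward-branch w↦x ((μ , ν) , v↦w , s) with predecessor-form v↦w
        ... | e , refl , refl , e²≡α²-β² =
          Sum.map (λ □ → _ , v↦w , IsSquare⇒predecessor s □)
                  (λ □ → _ , v′↦w′ , IsSquare⇒predecessor (proj₁ v′↦w′) □)
                  (one-square (backward-classes w↦x e²≡α²-β²))
          where v′↦w′ = σ-predecessor (proj₁ w↦x) e²≡α²-β²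

        midpoint-TwoToTwo : TwoToTwo _↦_ S swap neg₂
        midpoint-TwoToTwo = record
          { σ-free = swap-free
          ; τ-free = neg-free
          ; source-S = proj₁
          ; target-S = proj₁ ∘ proj₂
          ; σ-source = ↦-swap
          ; τ-target = ↦-neg
          ; sources = sources
          ; targets = targets
          ; σ-target = λ x↦y → let _ , _ , _ , e²≡γ²-δ² = predecessor-form x↦y
                               in _ , σ-predecessor (proj₁ (proj₂ x↦y)) e²≡γ²-δ²
          ; τ-source = λ x↦z → _ , τ-successor x↦z
          ; forward-determined = λ x↦y x↦y′ y₂ y′₂ →
              [ sym , (λ y′≡-y → contradiction (subst (Fwd 2) y′≡-y y′₂) (forward-exclusive x↦y y₂)) ]′
                (targets x↦y x↦y′)
          ; backward-determined = λ x↦y x′↦y x₂ x′₂ →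
              [ sym , (λ x′≡σx → contradiction (subst (Bwd 2) x′≡σx x′₂) (backward-exclusive x↦y x₂)) ]′
                (sources x↦y x′↦y)
          ; forward-branch = forward-branch
          ; backward-branch = backward-branch
          }

module _ {A : Set} (F : Field A) where
  open FieldDefs F
  open Chains _↦_ S using () renaming (Chain to Fwd; Chain∞ to Fwd∞)
  open Chains (flip _↦_) S using () renaming (Chain to Bwd; Chain∞ to Bwd∞)

  Adv≐Fwd : ∀ n → Adv n ≐ Fwd n
  Adv≐Fwd zero = id , id
  Adv≐Fwd (suc n) = (λ (y , x↦y , a) → y , x↦y , proj₁ (Adv≐Fwd n) a)
                  , (λ (y , x↦y , f) → y , x↦y , proj₂ (Adv≐Fwd n) f)

  Back≐Bwd : ∀ n → Back n ≐ Bwd n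
  Back≐Bwd zero = id , id
  Back≐Bwd (suc n) = (λ (y , y↦x , b) → y , y↦x , proj₁ (Back≐Bwd n) b)
                   , (λ (y , y↦x , b) → y , y↦x , proj₂ (Back≐Bwd n) b)

  AdvInf≐Fwd∞ : AdvInf ≐ Fwd∞
  AdvInf≐Fwd∞ = (λ a n → proj₁ (Adv≐Fwd n) (a n)) , (λ f n → proj₂ (Adv≐Fwd n) (f n))

  BackInf≐Bwd∞ : BackInf ≐ Bwd∞
  BackInf≐Bwd∞ = (λ b n → proj₁ (Back≐Bwd n) (b n)) , (λ b n → proj₂ (Back≐Bwd n) (b n))

pairs-↣ : ∀ {q} → (Fin q × Fin q) ↣ ℕ
pairs-↣ = mk↣ {to = λ (a , b) → Fin.toℕ (Fin.combine a b)} λ {(a , b)} {(c , d)} e →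
  let a≡c , b≡d = Fin.combine-injective a b c d (Fin.toℕ-injective e) in cong₂ _,_ a≡c b≡d

open import Data.Nat using (_*_; _%_)

five-mod-eight : ∀ q → q % 8 ≡ 5 → q ≡ suc (2 * (2 * suc (2 * (q ℕ./ 8))))
five-mod-eight q q%8≡5 =
  trans (ℕ.m≡m%n+[m/n]*n q 8) (trans (cong (ℕ._+ (q ℕ./ 8) * 8) q%8≡5) (arithmetic (q ℕ./ 8)))
  where
  open +-*-Solver
  arithmetic : ∀ k → 5 ℕ.+ k * 8 ≡ suc (2 * (2 * suc (2 * k)))
  arithmetic = solve 1 (λ k → con 5 :+ k :* con 8 := con 1 :+ con 2 :* (con 2 :* (con 1 :+ con 2 :* k))) refl

theorem4p8 : (q : ℕ) → IsPrimePower q → q % 8 ≡ 5 → (F : Field (Fin q)) →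
    let open FieldDefs F in
    (a b c : ℕ) →
    HasSize (λ x → AdvInf x × BackInf x) a → HasSize AdvInf b → HasSize BackInf c →
    (4 * a ≡ b) × (4 * a ≡ c)
theorem4p8 q _ q%8≡5 F a b c C-size Adv-size Back-size =
    Quarter.quarter T pairs-↣ _↦?_ Fwd∞∩Bwd∞-size (HasSize-cong (AdvInf≐Fwd∞ F) Adv-size)
  , Quarter.quarter (dual T) pairs-↣ (flip _↦?_) (HasSize-cong (swap , swap) Fwd∞∩Bwd∞-size)
                    (HasSize-cong (BackInf≐Bwd∞ F) Back-size)
  where
  k = q ℕ./ 8
  q≡1+4[1+2k] = five-mod-eight q q%8≡5
  open FiniteFieldArithmetic F
  open OddOrder (2 * suc (2 * k)) q≡1+4[1+2k]
  open MidpointDynamics F Fin._≟_ using (_↦?_; midpoint-TwoToTwo)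
  i,i²≡-1 = -1-square {suc (2 * k)} q≡1+4[1+2k]
  T = midpoint-TwoToTwo 2#≢0# (proj₂ i,i²≡-1) (i-nonsquare {k} q≡1+4[1+2k] (proj₂ i,i²≡-1))
                        IsSquare? nonsquare-product
  Fwd∞∩Bwd∞-size = HasSize-cong
    ( (λ (a∞ , b∞) → proj₁ (AdvInf≐Fwd∞ F) a∞ , proj₁ (BackInf≐Bwd∞ F) b∞)
    , (λ (f∞ , b∞) → proj₂ (AdvInf≐Fwd∞ F) f∞ , proj₂ (BackInf≐Bwd∞ F) b∞)) C-size
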